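{- For each finite irreflexive transitive tree-like Kripke frame $\mathcal T=(T,R_0)$ with root $r$ there exist an ordinal $\lambda<\omega^\omega$ and a surjective map $f:[1,\lambda]\to T$ which is a $d$-map from $([1,\lambda],\vartheta_0)$ to $(T,\sigma_0)$, satisfies $f^{ -1}(A)\in\mathcal H_0([1,\lambda])$ for all $A\subseteq T$, and satisfies $f^{ -1}(r)=\{\lambda\}$.
   Context: $\vartheta_0$ is the interval topology on ordinals (generated by $\{0\}$ and open intervals), taken on $[1,\lambda]$ as a subspace of $\lambda+1$. $\sigma_0$ is the topology on $T$ whose open sets are the $R_0$-upsets. A $d$-map is a continuous, open map all of whose fibers are discrete subspaces. A word is a map $A:\alpha\to\{0,1\}$ with natural concatenation and iteration; $X$ is periodic if $X=A^\mu$ for a limit $\mu$ and nonempty $A$, u.p. if $X=BY$ with $Y$ periodic; a set $X$ is u.p. in $\Omega$ if the $\Omega$-word of $X\cap\Omega$ (characteristic function) is u.p.; $X\subseteq\Omega$ is h.p. in $\Omega$ if u.p. in every limit $\beta\le\Omega$; $\mathcal H_0(\Omega)$ is the set of these; $\mathcal H_0([1,\lambda])=\{A\cap[1,\lambda]:A\in\mathcal H_0(\lambda+1)\}$. -}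

module Defs where

open import Data.Nat as ℕ using (ℕ; zero; suc)
open import Data.Bool using (Bool; true; false)
open import Data.List using (List; []; _∷_; _++_; replicate; length; drop)
open import Data.Fin using (Fin)
open import Data.Product using (Σ; ∃; ∃₂; _×_; _,_)
open import Data.Sum using (_⊎_)
open import Relation.Binary.PropositionalEquality using (_≡_; _≢_)

-- Ordinals below ω^ω in (canonical) Cantor normal form.
-- A nonzero ordinal is a list of coefficients, lowest degree first,
-- whose last (highest-degree) coefficient is nonzero:
--   top c   denotes  c + 1
--   c ◂ p   denotes  ω · p + c        (p nonzero)
-- so every ordinal < ω^ω has exactly one representation and
-- ordinal equality is propositional equality.

data Pos : Set where
  top : ℕ → Pos
  _◂_ : ℕ → Pos → Pos

data Ord : Set where
  𝟎   : Ord
  pos : Pos → Ord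

𝟏 : Ord
𝟏 = pos (top 0)

posList : Pos → List ℕ
posList (top c) = suc c ∷ []
posList (c ◂ p) = c ∷ posList p

toList : Ord → List ℕ
toList 𝟎 = []
toList (pos p) = posList p

consOrd : ℕ → Ord → Ord
consOrd zero    𝟎 = 𝟎
consOrd (suc k) 𝟎 = pos (top k)
consOrd c (pos p) = pos (c ◂ p)

fromList : List ℕ → Ord
fromList [] = 𝟎
fromList (c ∷ cs) = consOrd c (fromList cs)

data Cmp : Set where
  lt eq gt : Cmp

cmpℕ : ℕ → ℕ → Cmp
cmpℕ zero zero = eq
cmpℕ zero (suc _) = lt
cmpℕ (suc _) zero = gt
cmpℕ (suc m) (suc n) = cmpℕ m n

lexThen : Cmp → Cmp → Cmp
lexThen eq o = o
lexThen lt _ = lt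
lexThen gt _ = gt

cmpPos : Pos → Pos → Cmp
cmpPos (top a) (top b) = cmpℕ a b
cmpPos (top a) (_ ◂ _) = lt
cmpPos (_ ◂ _) (top _) = gt
cmpPos (a ◂ p) (b ◂ q) = lexThen (cmpPos p q) (cmpℕ a b)

cmpOrd : Ord → Ord → Cmp
cmpOrd 𝟎 𝟎 = eq
cmpOrd 𝟎 (pos _) = lt
cmpOrd (pos _) 𝟎 = gt
cmpOrd (pos p) (pos q) = cmpPos p q

infix 4 _<_ _≤_
_<_ : Ord → Ord → Set
α < β = cmpOrd α β ≡ lt

_≤_ : Ord → Ord → Set
α ≤ β = α < β ⊎ α ≡ β

hd : List ℕ → ℕ
hd [] = 0
hd (x ∷ _) = x

addL : List ℕ → List ℕ → List ℕ
addL a [] = a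
addL a (b ∷ []) = (hd a ℕ.+ b) ∷ drop 1 a
addL a (b ∷ c ∷ bs) = b ∷ addL (drop 1 a) (c ∷ bs)

infixl 6 _+_
_+_ : Ord → Ord → Ord
α + β = fromList (addL (toList α) (toList β))

scaleTop : List ℕ → ℕ → List ℕ
scaleTop [] k = []
scaleTop (x ∷ []) k = x ℕ.* k ∷ []
scaleTop (x ∷ y ∷ r) k = x ∷ scaleTop (y ∷ r) k

mulL : List ℕ → List ℕ → List ℕ
mulL [] _ = []
mulL (_ ∷ _) [] = []
mulL a@(_ ∷ _) (zero ∷ bs) = replicate (length a) 0 ++ bs
mulL a@(_ ∷ _) (suc b ∷ bs) = scaleTop a (suc b) ++ bs

infixl 7 _*_
_*_ : Ord → Ord → Ord
α * β = fromList (mulL (toList α) (toList β))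

Limit : Ord → Set
Limit μ = (μ ≢ 𝟎) × (∀ ν → μ ≢ ν + 𝟏)

-- Words: maps α → {0,1}; only the values below `len` matter.

record Word : Set where
  constructor ⟨_,_⟩
  field
    len : Ord
    at  : Ord → Bool
open Word public

Concat : Word → Word → Word → Set
Concat X B Y =
  (len X ≡ len B + len Y)
  × (∀ γ → γ < len B → at X γ ≡ at B γ)
  × (∀ δ → δ < len Y → at X (len B + δ) ≡ at Y δ)

Pow : Word → Word → Ord → Set
Pow Y A μ =
  (len Y ≡ len A * μ)
  × (∀ ξ δ → ξ < μ → δ < len A → at Y (len A * ξ + δ) ≡ at A δ)

Periodic : Word → Set
Periodic X = ∃₂ λ (A : Word) (μ : Ord) → Limit μ × (len A ≢ 𝟎) × Pow X A μ

UltPer : Word → Set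
UltPer X = ∃₂ λ (B Y : Word) → Periodic Y × Concat X B Y

-- sets of ordinals are given by characteristic functions
UPin : (Ord → Bool) → Ord → Set
UPin P Ω = UltPer ⟨ Ω , P ⟩

HPin : (Ord → Bool) → Ord → Set
HPin P Ω = (∀ γ → P γ ≡ true → γ < Ω) × (∀ β → Limit β → β ≤ Ω → UPin P β)

InI : Ord → Ord → Set
InI lam x = (𝟏 ≤ x) × (x ≤ lam)

-- S (restricted to [1,lam]) belongs to H₀([1,lam])
InH0 : Ord → (Ord → Bool) → Set
InH0 lam S = ∃ λ P → HPin P (lam + 𝟏) × (∀ γ → InI lam γ → P γ ≡ S γ)

-- Topology ϑ₀: generated by {0} and open intervals (a,b)

Interval : Ord → Ord → Ord → Set
Interval a b x = (a < x) × (x < b)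

OpenOrd : (Ord → Set) → Set
OpenOrd U = ∀ x → U x →
  (x ≡ 𝟎) ⊎ (∃₂ λ a b → Interval a b x × (∀ y → Interval a b y → U y))

OpenSub : Ord → (Ord → Set) → Set₁
OpenSub lam U = ∃ λ (V : Ord → Set) → OpenOrd V ×
  (∀ x → (U x → V x × InI lam x) × (V x × InI lam x → U x))

module _ {n : ℕ} (R : Fin n → Fin n → Bool) where

  Irreflexive : Set
  Irreflexive = ∀ t → R t t ≡ false

  Transitive : Set
  Transitive = ∀ s t u → R s t ≡ true → R t u ≡ true → R s u ≡ true

  TreeLike : Fin n → Set
  TreeLike r = (∀ t → t ≢ r → R r t ≡ true)
    × (∀ s s' t → R s t ≡ true → R s' t ≡ true →
         (s ≡ s') ⊎ (R s s' ≡ true) ⊎ (R s' s ≡ true))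

  -- σ₀-open sets: R-upsets
  Upset : (Fin n → Set) → Set
  Upset U = ∀ s t → U s → R s t ≡ true → U t

  -- d-maps ([1,lam], ϑ₀) → (Fin n, σ₀); f matters only on [1,lam]
  Continuous : Ord → (Ord → Fin n) → Set₁
  Continuous lam f = ∀ (U : Fin n → Set) → Upset U →
    OpenSub lam (λ x → InI lam x × U (f x))

  OpenMap : Ord → (Ord → Fin n) → Set₁
  OpenMap lam f = ∀ (U : Ord → Set) → OpenSub lam U →
    Upset (λ t → ∃ λ x → U x × f x ≡ t)

  DiscreteFibers : Ord → (Ord → Fin n) → Set₁
  DiscreteFibers lam f = ∀ x → InI lam x →
    ∃ λ (U : Ord → Set) → OpenSub lam U × U x × (∀ y → U y → f y ≡ f x → y ≡ x)

  DMap : Ord → (Ord → Fin n) → Set₁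
  DMap lam f = Continuous lam f × OpenMap lam f × DiscreteFibers lam f

{-# OPTIONS --safe #-}
-- Each point t is realised by a map label t on (0, λ t] whose values lie in the reflexive
-- upset of t, with t at λ t alone.  A point without successors gets λ t = 1.  Otherwise
-- the maps of all successors s of t are glued side by side into a block of length
-- σ = Σ λ s, the block is repeated ω times, and t is put on top: λ t = σ · ω.
-- Inductively every z in (0, λ t] has a left neighbourhood that is mapped into the upset
-- of its value, meets that value only at z, and hits every successor of it arbitrarily
-- close to z: this gives continuity, discrete fibres and openness.  Every limit z ends a
-- stretch of length σ · ω on which the map is σ-periodic, so every preimage is
-- hereditarily ultimately periodic.  The recursion is on the number of successors, which
-- drops along the finite strict order R; λ < ω^ω holds because Ord only has such ordinals.
module Submission where

open import Defs
open import Data.Nat as ℕ using (ℕ; zero; suc)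
import Data.Nat.Properties as ℕₚ
open import Data.Bool using (Bool; true; false; _≟_)
open import Data.Bool.Properties using (¬-not)
open import Data.List using (List; []; _∷_; _++_; replicate; filter; length; allFin)
open import Data.List.Properties using (filter-accept; filter-reject; filter-notAll)
open import Data.List.Membership.Propositional using (_∈_)
open import Data.List.Membership.Propositional.Properties
  using (∈-filter⁺; ∈-filter⁻; ∈-allFin; ∈-length)
open import Data.List.Relation.Unary.Any as Any using (here; there)
open import Relation.Unary using (Decidable)
open import Data.Fin using (Fin) renaming (_≟_ to _≟ᶠ_)
open import Data.Product using (Σ; ∃; ∃₂; _×_; _,_; proj₁; proj₂)
open import Data.Sum using (_⊎_; inj₁; inj₂)
open import Data.Empty using (⊥-elim)
open import Level using (0ℓ)
open import Relation.Nullary using (¬_; Dec; yes; no; _×-dec_)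
open import Relation.Binary.Bundles using (StrictPartialOrder)
open import Relation.Binary.Definitions using (Trichotomous; Tri; tri<; tri≈; tri>)
open import Relation.Binary.PropositionalEquality
open import Function using (_∘_; case_of_)
open import Data.Nat.Tactic.RingSolver using (solve-∀)
import Relation.Binary.Construct.StrictToNonStrict _≡_ _<_ as NonStrict

flipCmp : Cmp → Cmp
flipCmp lt = gt
flipCmp eq = eq
flipCmp gt = lt

eq≢lt : eq ≢ lt
eq≢lt ()

gt≢lt : gt ≢ lt
gt≢lt ()

cmpℕ-refl : ∀ m → cmpℕ m m ≡ eq
cmpℕ-refl zero    = refl
cmpℕ-refl (suc m) = cmpℕ-refl m

cmpℕ≡eq⇒≡ : ∀ m n → cmpℕ m n ≡ eq → m ≡ n
cmpℕ≡eq⇒≡ zero    zero    _ = refl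
cmpℕ≡eq⇒≡ zero    (suc n) ()
cmpℕ≡eq⇒≡ (suc m) zero    ()
cmpℕ≡eq⇒≡ (suc m) (suc n) e = cong suc (cmpℕ≡eq⇒≡ m n e)

cmpℕ[n,0]≢lt : ∀ n → cmpℕ n 0 ≢ lt
cmpℕ[n,0]≢lt zero    ()
cmpℕ[n,0]≢lt (suc _) ()

cmpℕ-flip : ∀ m n → cmpℕ n m ≡ flipCmp (cmpℕ m n)
cmpℕ-flip zero    zero    = refl
cmpℕ-flip zero    (suc n) = refl
cmpℕ-flip (suc m) zero    = refl
cmpℕ-flip (suc m) (suc n) = cmpℕ-flip m n

cmpℕ≡lt⇒< : ∀ m n → cmpℕ m n ≡ lt → m ℕ.< n
cmpℕ≡lt⇒< zero    (suc n) _ = ℕ.z<s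
cmpℕ≡lt⇒< (suc m) (suc n) e = ℕ.s<s (cmpℕ≡lt⇒< m n e)
cmpℕ≡lt⇒< zero    zero    ()
cmpℕ≡lt⇒< (suc m) zero    ()

<⇒cmpℕ≡lt : ∀ {m n} → m ℕ.< n → cmpℕ m n ≡ lt
<⇒cmpℕ≡lt {zero}  ℕ.z<s       = refl
<⇒cmpℕ≡lt {suc m} (ℕ.s<s m<n) = <⇒cmpℕ≡lt m<n

lexThen-flip : ∀ x y → flipCmp (lexThen x y) ≡ lexThen (flipCmp x) (flipCmp y)
lexThen-flip lt y = refl
lexThen-flip eq y = refl
lexThen-flip gt y = refl

lexThen≡eq : ∀ x y → lexThen x y ≡ eq → x ≡ eq × y ≡ eq
lexThen≡eq eq y e = refl , e
lexThen≡eq lt y ()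
lexThen≡eq gt y ()

LexLt : Cmp → Cmp → Set
LexLt x y = x ≡ lt ⊎ (x ≡ eq × y ≡ lt)

lexThen≡lt⇔ : ∀ x y → (lexThen x y ≡ lt → LexLt x y) × (LexLt x y → lexThen x y ≡ lt)
lexThen≡lt⇔ lt y = (λ _ → inj₁ refl) , (λ _ → refl)
lexThen≡lt⇔ eq y = inj₂ ∘ (refl ,_) , λ { (inj₁ ()) ; (inj₂ (_ , e)) → e }
lexThen≡lt⇔ gt y = (λ ()) , λ { (inj₁ ()) ; (inj₂ (() , _)) }

cmpℕ-trans : ∀ a b c → cmpℕ a b ≡ lt → cmpℕ b c ≡ lt → cmpℕ a c ≡ lt
cmpℕ-trans a b c a<b b<c =
  <⇒cmpℕ≡lt (ℕₚ.<-trans (cmpℕ≡lt⇒< a b a<b) (cmpℕ≡lt⇒< b c b<c))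

cmpPos-refl : ∀ p → cmpPos p p ≡ eq
cmpPos-refl (top c) = cmpℕ-refl c
cmpPos-refl (c ◂ p) rewrite cmpPos-refl p = cmpℕ-refl c

cmpPos≡eq⇒≡ : ∀ p q → cmpPos p q ≡ eq → p ≡ q
cmpPos≡eq⇒≡ (top a) (top b) e = cong top (cmpℕ≡eq⇒≡ a b e)
cmpPos≡eq⇒≡ (a ◂ p) (b ◂ q) e =
  let p≡q , a≡b = lexThen≡eq (cmpPos p q) (cmpℕ a b) e
  in cong₂ _◂_ (cmpℕ≡eq⇒≡ a b a≡b) (cmpPos≡eq⇒≡ p q p≡q)
cmpPos≡eq⇒≡ (top _) (_ ◂ _) ()
cmpPos≡eq⇒≡ (_ ◂ _) (top _) ()

cmpPos-flip : ∀ p q → cmpPos q p ≡ flipCmp (cmpPos p q)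
cmpPos-flip (top a) (top b) = cmpℕ-flip a b
cmpPos-flip (top a) (b ◂ q) = refl
cmpPos-flip (a ◂ p) (top b) = refl
cmpPos-flip (a ◂ p) (b ◂ q) rewrite cmpPos-flip p q | cmpℕ-flip a b =
  sym (lexThen-flip (cmpPos p q) (cmpℕ a b))

cmpPos-trans : ∀ p q r → cmpPos p q ≡ lt → cmpPos q r ≡ lt → cmpPos p r ≡ lt
cmpPos-trans (top a) (top b) (top c) a<b b<c = cmpℕ-trans a b c a<b b<c
cmpPos-trans (top _) (top _) (_ ◂ _) _   _ = refl
cmpPos-trans (top _) (_ ◂ _) (_ ◂ _) _   _ = refl
cmpPos-trans (top _) (_ ◂ _) (top _) _   ()
cmpPos-trans (_ ◂ _) (top _) _       ()  _
cmpPos-trans (_ ◂ _) (_ ◂ _) (top _) _   ()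
cmpPos-trans (a ◂ p) (b ◂ q) (c ◂ r) h₁ h₂ =
  proj₂ (lexThen≡lt⇔ _ _)
    (lexLt-trans (proj₁ (lexThen≡lt⇔ _ _) h₁) (proj₁ (lexThen≡lt⇔ _ _) h₂))
  where
  lexLt-trans : LexLt (cmpPos p q) (cmpℕ a b) → LexLt (cmpPos q r) (cmpℕ b c) →
                LexLt (cmpPos p r) (cmpℕ a c)
  lexLt-trans (inj₁ p<q) (inj₁ q<r) = inj₁ (cmpPos-trans p q r p<q q<r)
  lexLt-trans (inj₁ p<q) (inj₂ (q≡r , _)) with refl ← cmpPos≡eq⇒≡ q r q≡r = inj₁ p<q
  lexLt-trans (inj₂ (p≡q , _)) (inj₁ q<r) with refl ← cmpPos≡eq⇒≡ p q p≡q = inj₁ q<r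
  lexLt-trans (inj₂ (p≡q , a<b)) (inj₂ (q≡r , b<c))
    with refl ← cmpPos≡eq⇒≡ p q p≡q | refl ← cmpPos≡eq⇒≡ q r q≡r =
    inj₂ (cmpPos-refl p , cmpℕ-trans a b c a<b b<c)

cmp-refl : ∀ a → cmpOrd a a ≡ eq
cmp-refl 𝟎       = refl
cmp-refl (pos p) = cmpPos-refl p

cmp≡eq⇒≡ : ∀ a b → cmpOrd a b ≡ eq → a ≡ b
cmp≡eq⇒≡ 𝟎       𝟎       _ = refl
cmp≡eq⇒≡ (pos p) (pos q) e = cong pos (cmpPos≡eq⇒≡ p q e)
cmp≡eq⇒≡ 𝟎       (pos _) ()
cmp≡eq⇒≡ (pos _) 𝟎       ()

cmp-flip : ∀ a b → cmpOrd b a ≡ flipCmp (cmpOrd a b)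
cmp-flip 𝟎       𝟎       = refl
cmp-flip 𝟎       (pos _) = refl
cmp-flip (pos _) 𝟎       = refl
cmp-flip (pos p) (pos q) = cmpPos-flip p q

<-irrefl : ∀ {a b} → a ≡ b → ¬ a < b
<-irrefl {a} refl a<a = eq≢lt (trans (sym (cmp-refl a)) a<a)

<-asym : ∀ {a b} → a < b → ¬ b < a
<-asym {a} {b} a<b b<a = gt≢lt (trans (cong flipCmp (sym a<b)) (trans (sym (cmp-flip a b)) b<a))

<-trans : ∀ {a b c} → a < b → b < c → a < c
<-trans {pos p} {pos q} {pos r} = cmpPos-trans p q r
<-trans {𝟎} {pos _} {pos _} _ _ = refl
<-trans {𝟎} {𝟎} ()
<-trans {pos _} {𝟎} ()
<-trans {_} {pos _} {𝟎} _ ()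

<-cmp : Trichotomous _≡_ _<_
<-cmp a b = by-cmp (cmpOrd a b) refl
  where
  by-cmp : ∀ c → cmpOrd a b ≡ c → Tri (a < b) (a ≡ b) (b < a)
  by-cmp lt a<b = tri< a<b (λ a≡b → <-irrefl a≡b a<b) (<-asym {a} {b} a<b)
  by-cmp eq e   = let a≡b = cmp≡eq⇒≡ a b e in tri≈ (<-irrefl a≡b) a≡b (<-irrefl (sym a≡b))
  by-cmp gt e   = let b<a = trans (cmp-flip a b) (cong flipCmp e)
                  in tri> (<-asym {b} {a} b<a) (λ a≡b → <-irrefl (sym a≡b) b<a) b<a

<-strictPartialOrder : StrictPartialOrder 0ℓ 0ℓ 0ℓ
<-strictPartialOrder = record
  { isStrictPartialOrder = record
    { isEquivalence = isEquivalence
    ; irrefl        = <-irrefl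
    ; trans         = λ {a} {b} {c} → <-trans {a} {b} {c}
    ; <-resp-≈      = resp₂ _<_
    }
  }

open import Relation.Binary.Reasoning.StrictPartialOrder <-strictPartialOrder

≤-refl : ∀ {a} → a ≤ a
≤-refl = inj₂ refl

≤-trans : ∀ {a b c} → a ≤ b → b ≤ c → a ≤ c
≤-trans {a} {b} {c} =
  NonStrict.trans isEquivalence (resp₂ _<_) (λ {x y z} → <-trans {x} {y} {z}) {a} {b} {c}

≤-<-trans : ∀ {a b c} → a ≤ b → b < c → a < c
≤-<-trans {a} {b} {c} =
  NonStrict.≤-<-trans sym (λ {x y z} → <-trans {x} {y} {z}) (λ {x} → resp (_< x)) {a} {b} {c}

<-≤-trans : ∀ {a b c} → a < b → b ≤ c → a < c
<-≤-trans {a} {b} {c} =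
  NonStrict.<-≤-trans (λ {x y z} → <-trans {x} {y} {z}) (λ {x} → resp (x <_)) {a} {b} {c}

≤⇒≯ : ∀ {a b} → a ≤ b → ¬ b < a
≤⇒≯ {a} {b} (inj₁ a<b) = <-asym {a} {b} a<b
≤⇒≯ (inj₂ a≡b)         = <-irrefl (sym a≡b)

≮⇒≥ : ∀ {a b} → ¬ b < a → a ≤ b
≮⇒≥ {a} {b} b≮a with <-cmp a b
... | tri< a<b _ _ = inj₁ a<b
... | tri≈ _ a≡b _ = inj₂ a≡b
... | tri> _ _ b<a = ⊥-elim (b≮a b<a)

≤-antisym : ∀ {a b} → a ≤ b → b ≤ a → a ≡ b
≤-antisym {a} {b} = NonStrict.antisym isEquivalence (λ {x y z} → <-trans {x} {y} {z}) <-irrefl {a} {b}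

𝟎≤ : ∀ a → 𝟎 ≤ a
𝟎≤ 𝟎       = inj₂ refl
𝟎≤ (pos _) = inj₁ refl

≮𝟎 : ∀ {a} → ¬ a < 𝟎
≮𝟎 {𝟎}     ()
≮𝟎 {pos _} ()

𝟎<⇒≢𝟎 : ∀ {a} → 𝟎 < a → a ≢ 𝟎
𝟎<⇒≢𝟎 {pos _} _ ()

≢𝟎⇒𝟎< : ∀ {a} → a ≢ 𝟎 → 𝟎 < a
≢𝟎⇒𝟎< {𝟎}     a≢𝟎 = ⊥-elim (a≢𝟎 refl)
≢𝟎⇒𝟎< {pos _} _   = refl

-- Cantor normal form arithmetic: a = ω · quotω a + remω a

quotω : Ord → Ord
quotω 𝟎             = 𝟎
quotω (pos (top _)) = 𝟎
quotω (pos (_ ◂ p)) = pos p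

remω : Ord → ℕ
remω 𝟎             = 0
remω (pos (top c)) = suc c
remω (pos (c ◂ _)) = c

quotω-consOrd : ∀ c x → quotω (consOrd c x) ≡ x
quotω-consOrd zero    𝟎       = refl
quotω-consOrd (suc c) 𝟎       = refl
quotω-consOrd zero    (pos p) = refl
quotω-consOrd (suc c) (pos p) = refl

remω-consOrd : ∀ c x → remω (consOrd c x) ≡ c
remω-consOrd zero    𝟎       = refl
remω-consOrd (suc c) 𝟎       = refl
remω-consOrd zero    (pos p) = refl
remω-consOrd (suc c) (pos p) = refl

consOrd-remω-quotω : ∀ a → consOrd (remω a) (quotω a) ≡ a
consOrd-remω-quotω 𝟎                   = refl
consOrd-remω-quotω (pos (top c))       = refl
consOrd-remω-quotω (pos (zero ◂ p))    = refl
consOrd-remω-quotω (pos (suc c ◂ p))   = refl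

consOrd-pos : ∀ c p → consOrd c (pos p) ≡ pos (c ◂ p)
consOrd-pos zero    p = refl
consOrd-pos (suc c) p = refl

cmp-quotω-remω : ∀ a b →
  cmpOrd a b ≡ lexThen (cmpOrd (quotω a) (quotω b)) (cmpℕ (remω a) (remω b))
cmp-quotω-remω 𝟎             𝟎             = refl
cmp-quotω-remω 𝟎             (pos (top _)) = refl
cmp-quotω-remω 𝟎             (pos (_ ◂ _)) = refl
cmp-quotω-remω (pos (top _)) 𝟎             = refl
cmp-quotω-remω (pos (top _)) (pos (top _)) = refl
cmp-quotω-remω (pos (top _)) (pos (_ ◂ _)) = refl
cmp-quotω-remω (pos (_ ◂ _)) 𝟎             = refl
cmp-quotω-remω (pos (_ ◂ _)) (pos (top _)) = refl
cmp-quotω-remω (pos (_ ◂ _)) (pos (_ ◂ _)) = refl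

cmp-consOrd : ∀ c d x y → cmpOrd (consOrd c x) (consOrd d y) ≡ lexThen (cmpOrd x y) (cmpℕ c d)
cmp-consOrd c d x y
  rewrite cmp-quotω-remω (consOrd c x) (consOrd d y)
        | quotω-consOrd c x | quotω-consOrd d y | remω-consOrd c x | remω-consOrd d y = refl

consOrd-<-quotω : ∀ c d x y → x < y → consOrd c x < consOrd d y
consOrd-<-quotω c d x y x<y rewrite cmp-consOrd c d x y | x<y = refl

consOrd-<-remω : ∀ c d x → c ℕ.< d → consOrd c x < consOrd d x
consOrd-<-remω c d x c<d rewrite cmp-consOrd c d x x | cmp-refl x = <⇒cmpℕ≡lt c<d

fromList-posList : ∀ p → fromList (posList p) ≡ pos p
fromList-posList (top c) = refl
fromList-posList (c ◂ p) rewrite fromList-posList p = consOrd-pos c p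

+-identityʳ : ∀ a → a + 𝟎 ≡ a
+-identityʳ 𝟎       = refl
+-identityʳ (pos p) = fromList-posList p

+-top : ∀ a d → a + pos (top d) ≡ consOrd (remω a ℕ.+ suc d) (quotω a)
+-top 𝟎             d = refl
+-top (pos (top c)) d = refl
+-top (pos (c ◂ p)) d rewrite fromList-posList p = refl

+-◂ : ∀ a d q → a + pos (d ◂ q) ≡ consOrd d (quotω a + pos q)
+-◂ 𝟎             d (top _) = refl
+-◂ 𝟎             d (_ ◂ _) = refl
+-◂ (pos (top _)) d (top _) = refl
+-◂ (pos (top _)) d (_ ◂ _) = refl
+-◂ (pos (_ ◂ _)) d (top _) = refl
+-◂ (pos (_ ◂ _)) d (_ ◂ _) = refl

+-identityˡ : ∀ a → 𝟎 + a ≡ a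
+-identityˡ 𝟎       = refl
+-identityˡ (pos p) = 𝟎+pos p
  where
  𝟎+pos : ∀ p → 𝟎 + pos p ≡ pos p
  𝟎+pos (top _) = refl
  𝟎+pos (d ◂ q) rewrite +-◂ 𝟎 d q | 𝟎+pos q = consOrd-pos d q

<-+-pos : ∀ a q → a < a + pos q
<-+-pos a (top d) = begin-strict
  a                                      ≡⟨ consOrd-remω-quotω a ⟨
  consOrd (remω a) (quotω a)             <⟨ consOrd-<-remω _ _ (quotω a) (ℕₚ.m<m+n (remω a) ℕ.z<s) ⟩
  consOrd (remω a ℕ.+ suc d) (quotω a)   ≡⟨ +-top a d ⟨
  a + pos (top d)                        ∎
<-+-pos a (d ◂ q) = begin-strict
  a                                      ≡⟨ consOrd-remω-quotω a ⟨
  consOrd (remω a) (quotω a)             <⟨ consOrd-<-quotω (remω a) d _ _ (<-+-pos (quotω a) q) ⟩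
  consOrd d (quotω a + pos q)            ≡⟨ +-◂ a d q ⟨
  a + pos (d ◂ q)                        ∎

+-monoʳ-<-pos : ∀ a b q → b < pos q → a + b < a + pos q
+-monoʳ-<-pos a 𝟎 q _ rewrite +-identityʳ a = <-+-pos a q
+-monoʳ-<-pos a (pos (top e)) (top d) e<d rewrite +-top a e | +-top a d =
  consOrd-<-remω _ _ (quotω a) (ℕₚ.+-monoʳ-< (remω a) (ℕ.s<s (cmpℕ≡lt⇒< e d e<d)))
+-monoʳ-<-pos a (pos (top e)) (d ◂ q) _ rewrite +-top a e | +-◂ a d q =
  consOrd-<-quotω (remω a ℕ.+ suc e) d (quotω a) (quotω a + pos q) (<-+-pos (quotω a) q)
+-monoʳ-<-pos a (pos (e ◂ r)) (d ◂ q) er<dq rewrite +-◂ a e r | +-◂ a d q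
  with proj₁ (lexThen≡lt⇔ (cmpPos r q) (cmpℕ e d)) er<dq
... | inj₁ r<q = consOrd-<-quotω e d _ _ (+-monoʳ-<-pos (quotω a) (pos r) q r<q)
... | inj₂ (r≡q , e<d) with refl ← cmpPos≡eq⇒≡ r q r≡q =
  consOrd-<-remω e d _ (cmpℕ≡lt⇒< e d e<d)
+-monoʳ-<-pos a (pos (_ ◂ _)) (top _) ()

+-monoʳ-< : ∀ a b c → b < c → a + b < a + c
+-monoʳ-< a b (pos q) = +-monoʳ-<-pos a b q
+-monoʳ-< a b 𝟎 b<𝟎   = ⊥-elim (≮𝟎 {b} b<𝟎)

+-monoʳ-≤ : ∀ a b c → b ≤ c → a + b ≤ a + c
+-monoʳ-≤ a b c (inj₁ b<c) = inj₁ (+-monoʳ-< a b c b<c)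
+-monoʳ-≤ a b c (inj₂ refl) = ≤-refl

<-+ : ∀ a b → 𝟎 < b → a < a + b
<-+ a (pos q) _ = <-+-pos a q

≤-+ : ∀ a b → a ≤ a + b
≤-+ a 𝟎       = inj₂ (sym (+-identityʳ a))
≤-+ a (pos q) = inj₁ (<-+-pos a q)

𝟎<+ : ∀ a b → 𝟎 < b → 𝟎 < a + b
𝟎<+ a b 𝟎<b = begin-strict 𝟎 ≤⟨ 𝟎≤ a ⟩ a <⟨ <-+ a b 𝟎<b ⟩ a + b ∎

+-cancelˡ-< : ∀ a b c → a + b < a + c → b < c
+-cancelˡ-< a b c a+b<a+c with <-cmp b c
... | tri< b<c _ _ = b<c
... | tri≈ _ refl _ = ⊥-elim (<-irrefl {a + b} refl a+b<a+c)
... | tri> _ _ c<b = ⊥-elim (<-asym {a + b} {a + c} a+b<a+c (+-monoʳ-< a c b c<b))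

+-cancelˡ-≤ : ∀ a b c → a + b ≤ a + c → b ≤ c
+-cancelˡ-≤ a b c a+b≤a+c =
  ≮⇒≥ {b} {c} λ c<b → ≤⇒≯ {a + b} {a + c} a+b≤a+c (+-monoʳ-< a c b c<b)

a<a+w⇒𝟎<w : ∀ a w → a < a + w → 𝟎 < w
a<a+w⇒𝟎<w a w a<a+w = +-cancelˡ-< a 𝟎 w (subst (_< a + w) (sym (+-identityʳ a)) a<a+w)

+-cancelˡ-≡ : ∀ a {b c} → a + b ≡ a + c → b ≡ c
+-cancelˡ-≡ a {b} {c} e =
  ≤-antisym (+-cancelˡ-≤ a b c (inj₂ e)) (+-cancelˡ-≤ a c b (inj₂ (sym e)))

+-consOrd-pos : ∀ a d x → 𝟎 < x → a + consOrd d x ≡ consOrd d (quotω a + x)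
+-consOrd-pos a d (pos p) _ rewrite consOrd-pos d p = +-◂ a d p

+-assoc-pos : ∀ a b q → (a + b) + pos q ≡ a + (b + pos q)
+-assoc-pos a 𝟎 q rewrite +-identityʳ a | +-identityˡ (pos q) = refl
+-assoc-pos a (pos (top e)) (top d)
  rewrite +-top (a + pos (top e)) d | +-top a e
        | remω-consOrd (remω a ℕ.+ suc e) (quotω a) | quotω-consOrd (remω a ℕ.+ suc e) (quotω a)
        | +-top a (e ℕ.+ suc d) | ℕₚ.+-assoc (remω a) (suc e) (suc d) = refl
+-assoc-pos a (pos (e ◂ r)) (top d)
  rewrite +-top (a + pos (e ◂ r)) d | +-◂ a e r
        | remω-consOrd e (quotω a + pos r) | quotω-consOrd e (quotω a + pos r)
        | +-top (pos (e ◂ r)) d | consOrd-pos (e ℕ.+ suc d) r | +-◂ a (e ℕ.+ suc d) r = refl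
+-assoc-pos a (pos (top e)) (d ◂ q)
  rewrite +-◂ (a + pos (top e)) d q | +-top a e | quotω-consOrd (remω a ℕ.+ suc e) (quotω a)
        | +-◂ (pos (top e)) d q | +-identityˡ (pos q) | consOrd-pos d q | +-◂ a d q = refl
+-assoc-pos a (pos (e ◂ r)) (d ◂ q)
  rewrite +-◂ (a + pos (e ◂ r)) d q | +-◂ a e r | quotω-consOrd e (quotω a + pos r)
        | +-◂ (pos (e ◂ r)) d q | +-consOrd-pos a d (pos r + pos q) (𝟎<+ (pos r) (pos q) refl)
        | +-assoc-pos (quotω a) (pos r) q = refl

+-assoc : ∀ a b c → (a + b) + c ≡ a + (b + c)
+-assoc a b 𝟎 rewrite +-identityʳ (a + b) | +-identityʳ b = refl
+-assoc a b (pos q) = +-assoc-pos a b q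

+-finite : ∀ a k → a + consOrd k 𝟎 ≡ consOrd (remω a ℕ.+ k) (quotω a)
+-finite a zero    rewrite +-identityʳ a | ℕₚ.+-identityʳ (remω a) = sym (consOrd-remω-quotω a)
+-finite a (suc k) = +-top a k

consOrd-≤-remω : ∀ c d x → consOrd c x ≤ consOrd d x → c ℕ.≤ d
consOrd-≤-remω c d x (inj₁ c<d) rewrite cmp-consOrd c d x x | cmp-refl x =
  ℕₚ.<⇒≤ (cmpℕ≡lt⇒< c d c<d)
consOrd-≤-remω c d x (inj₂ e) =
  ℕₚ.≤-reflexive (trans (sym (remω-consOrd c x)) (trans (cong remω e) (remω-consOrd d x)))

consOrd-≤ : ∀ c d x y → x < y ⊎ (x ≡ y × c ℕ.≤ d) → consOrd c x ≤ consOrd d y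
consOrd-≤ c d x y (inj₁ x<y) = inj₁ (consOrd-<-quotω c d x y x<y)
consOrd-≤ c d x x (inj₂ (refl , c≤d)) with ℕₚ.m≤n⇒m<n∨m≡n c≤d
... | inj₁ c<d  = inj₁ (consOrd-<-remω c d x c<d)
... | inj₂ refl = ≤-refl

x<x+𝟏 : ∀ x → x < x + 𝟏
x<x+𝟏 x = <-+ x 𝟏 refl

x+𝟏≡consOrd : ∀ x → x + 𝟏 ≡ consOrd (suc (remω x)) (quotω x)
x+𝟏≡consOrd x rewrite +-top x 0 | ℕₚ.+-comm (remω x) 1 = refl

<⇒+𝟏≤ : ∀ x y → x < y → x + 𝟏 ≤ y
<⇒+𝟏≤ x y x<y = begin
  x + 𝟏                              ≡⟨ x+𝟏≡consOrd x ⟩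
  consOrd (suc (remω x)) (quotω x)   ≤⟨ consOrd-≤ _ _ (quotω x) (quotω y) (lexLt⇒ lex) ⟩
  consOrd (remω y) (quotω y)         ≡⟨ consOrd-remω-quotω y ⟩
  y                                  ∎
  where
  lex = proj₁ (lexThen≡lt⇔ _ _) (trans (sym (cmp-quotω-remω x y)) x<y)
  lexLt⇒ : LexLt (cmpOrd (quotω x) (quotω y)) (cmpℕ (remω x) (remω y)) →
           quotω x < quotω y ⊎ (quotω x ≡ quotω y × remω x ℕ.< remω y)
  lexLt⇒ (inj₁ q<q′) = inj₁ q<q′
  lexLt⇒ (inj₂ (q≡q′ , r<r′)) = inj₂ (cmp≡eq⇒≡ _ _ q≡q′ , cmpℕ≡lt⇒< _ _ r<r′)

<+𝟏⇒≤ : ∀ y x → y < x + 𝟏 → y ≤ x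
<+𝟏⇒≤ y x y<x+𝟏 =
  ≮⇒≥ {y} {x} λ x<y → ≤⇒≯ {x + 𝟏} {y} (<⇒+𝟏≤ x y x<y) y<x+𝟏

𝟎<⇒𝟏≤ : ∀ x → 𝟎 < x → 𝟏 ≤ x
𝟎<⇒𝟏≤ x = <⇒+𝟏≤ 𝟎 x

𝟏≤⇒𝟎< : ∀ x → 𝟏 ≤ x → 𝟎 < x
𝟏≤⇒𝟎< x 𝟏≤x = begin-strict 𝟎 <⟨ refl ⟩ 𝟏 ≤⟨ 𝟏≤x ⟩ x ∎

ω : Ord
ω = pos (0 ◂ top 0)

ω-limit : Limit ω
ω-limit = (λ ()) , λ ν ω≡ν+𝟏 →
  0≢suc (trans (cong remω ω≡ν+𝟏)
               (trans (cong remω (x+𝟏≡consOrd ν)) (remω-consOrd _ (quotω ν))))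
  where
  0≢suc : ∀ {k} → 0 ≢ suc k
  0≢suc ()

𝟏-not-limit : ¬ Limit 𝟏
𝟏-not-limit (_ , not-succ) = not-succ 𝟎 refl

Limit-≤+𝟏 : ∀ β Λ → Limit β → β ≤ Λ + 𝟏 → β ≤ Λ
Limit-≤+𝟏 β Λ _             (inj₁ β<Λ+𝟏) = <+𝟏⇒≤ β Λ β<Λ+𝟏
Limit-≤+𝟏 β Λ (_ , not-succ) (inj₂ β≡Λ+𝟏) = ⊥-elim (not-succ Λ β≡Λ+𝟏)

Limit-+ : ∀ o w → 𝟎 < w → Limit (o + w) → Limit w
Limit-+ o w 𝟎<w (_ , not-succ) =
  𝟎<⇒≢𝟎 {w} 𝟎<w ,
  λ ν w≡ν+𝟏 → not-succ (o + ν) (trans (cong (o +_) w≡ν+𝟏) (sym (+-assoc o ν 𝟏)))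

infixl 6 _∸ᵖ_ _∸_

_∸ᵖ_ : Ord → Pos → Ord
𝟎           ∸ᵖ top c = 𝟎
pos (top d) ∸ᵖ top c = consOrd (d ℕ.∸ c) 𝟎
pos (d ◂ r) ∸ᵖ top c = pos (d ◂ r)
z ∸ᵖ (c ◂ q) with cmpOrd (pos q) (quotω z)
... | lt = consOrd (remω z) (quotω z ∸ᵖ q)
... | eq = consOrd (remω z ℕ.∸ c) 𝟎
... | gt = 𝟎

_∸_ : Ord → Ord → Ord
z ∸ 𝟎     = z
z ∸ pos p = z ∸ᵖ p

a+[z∸ᵖa]≡z : ∀ p z → pos p ≤ z → pos p + (z ∸ᵖ p) ≡ z
a+[z∸ᵖa]≡z (top c) (pos (top d)) c≤d
  rewrite +-finite (pos (top c)) (d ℕ.∸ c)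
        | ℕₚ.m+[n∸m]≡n (ℕₚ.≤-pred (consOrd-≤-remω (suc c) (suc d) 𝟎 c≤d)) = refl
a+[z∸ᵖa]≡z (top c) (pos (d ◂ r)) _
  rewrite +-◂ (pos (top c)) d r | +-identityˡ (pos r) = consOrd-pos d r
a+[z∸ᵖa]≡z (c ◂ q) (pos (d ◂ r)) a≤z with cmpPos q r in q?r
... | lt with pos r ∸ᵖ q in w≡ | a+[z∸ᵖa]≡z q (pos r) (inj₁ q?r)
...   | 𝟎     | q+𝟎≡r = ⊥-elim (<-irrefl (trans (sym (+-identityʳ (pos q))) q+𝟎≡r) q?r)
...   | pos w | q+w≡r rewrite consOrd-pos d w | +-◂ (pos (c ◂ q)) d w | q+w≡r = consOrd-pos d r
a+[z∸ᵖa]≡z (c ◂ q) (pos (d ◂ r)) a≤z | eq with refl ← cmpPos≡eq⇒≡ q r q?r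
  rewrite +-finite (pos (c ◂ q)) (d ℕ.∸ c) =
  trans (cong (λ k → consOrd k (pos q)) (ℕₚ.m+[n∸m]≡n c≤d)) (consOrd-pos d q)
  where
  c≤d : c ℕ.≤ d
  c≤d = case a≤z of λ where
    (inj₁ c<d)  → ℕₚ.<⇒≤ (cmpℕ≡lt⇒< c d c<d)
    (inj₂ refl) → ℕₚ.≤-refl
a+[z∸ᵖa]≡z (c ◂ q) (pos (d ◂ r)) (inj₁ a<z) | gt = ⊥-elim (gt≢lt a<z)
a+[z∸ᵖa]≡z (c ◂ q) (pos (d ◂ r)) (inj₂ refl) | gt =
  case trans (sym (cmpPos-refl q)) q?r of λ ()
a+[z∸ᵖa]≡z p 𝟎 a≤𝟎 = ⊥-elim (≤⇒≯ {pos p} {𝟎} a≤𝟎 refl)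
a+[z∸ᵖa]≡z (_ ◂ _) (pos (top _)) (inj₁ ())
a+[z∸ᵖa]≡z (_ ◂ _) (pos (top _)) (inj₂ ())

a+[z∸a]≡z : ∀ a z → a ≤ z → a + (z ∸ a) ≡ z
a+[z∸a]≡z 𝟎       z _   = +-identityˡ z
a+[z∸a]≡z (pos p) z a≤z = a+[z∸ᵖa]≡z p z a≤z

a+w∸a≡w : ∀ a w → a + w ∸ a ≡ w
a+w∸a≡w a w = +-cancelˡ-≡ a (a+[z∸a]≡z a (a + w) (≤-+ a w))

a≤z⇒∃[w]a+w≡z : ∀ a z → a ≤ z → ∃ λ w → a + w ≡ z
a≤z⇒∃[w]a+w≡z a z a≤z = z ∸ a , a+[z∸a]≡z a z a≤z

fromℕ : ℕ → Ord
fromℕ zero    = 𝟎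
fromℕ (suc k) = pos (top k)

mulSuc : Pos → ℕ → Pos
mulSuc (top c) k = top (k ℕ.+ c ℕ.* suc k)
mulSuc (c ◂ q) k = c ◂ mulSuc q k

mulω : Pos → Pos
mulω (top _) = 0 ◂ top 0
mulω (_ ◂ q) = 0 ◂ mulω q

*-𝟎 : ∀ a → a * 𝟎 ≡ 𝟎
*-𝟎 𝟎             = refl
*-𝟎 (pos (top _)) = refl
*-𝟎 (pos (_ ◂ _)) = refl

*-fromℕ-suc : ∀ p k → pos p * fromℕ (suc k) ≡ pos (mulSuc p k)
*-fromℕ-suc (top c) k = refl
*-fromℕ-suc (c ◂ q) k = normalise (c ◂ q)
  where
  normalise : ∀ p → fromList (scaleTop (posList p) (suc k) ++ []) ≡ pos (mulSuc p k)
  normalise (top c)       = refl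
  normalise (c ◂ top d)   = consOrd-pos c _
  normalise (c ◂ (d ◂ q)) rewrite normalise (d ◂ q) = consOrd-pos c _

*-ω : ∀ p → pos p * ω ≡ pos (mulω p)
*-ω (top c) = refl
*-ω (c ◂ q) = normalise (c ◂ q)
  where
  normalise : ∀ p → fromList (replicate (length (posList p)) 0 ++ (1 ∷ [])) ≡ pos (mulω p)
  normalise (top c) = refl
  normalise (c ◂ q) rewrite normalise q = refl

mulSuc-zero : ∀ p → mulSuc p 0 ≡ p
mulSuc-zero (top c) = cong top (ℕₚ.*-identityʳ c)
mulSuc-zero (c ◂ q) = cong (c ◂_) (mulSuc-zero q)

+-mulSuc : ∀ p k → pos p + pos (mulSuc p k) ≡ pos (mulSuc p (suc k))
+-mulSuc (top c) k = cong (pos ∘ top) (solve c k)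
  where
  solve : ∀ c k → c ℕ.+ suc (k ℕ.+ c ℕ.* suc k) ≡ suc k ℕ.+ c ℕ.* suc (suc k)
  solve = solve-∀
+-mulSuc (c ◂ q) k rewrite +-◂ (pos (c ◂ q)) c (mulSuc q k) | +-mulSuc q k = consOrd-pos c _

mulSuc-+ : ∀ p k → pos (mulSuc p k) + pos p ≡ pos (mulSuc p (suc k))
mulSuc-+ (top c) k = cong (pos ∘ top) (solve c k)
  where
  solve : ∀ c k → k ℕ.+ c ℕ.* suc k ℕ.+ suc c ≡ suc k ℕ.+ c ℕ.* suc (suc k)
  solve = solve-∀
mulSuc-+ (c ◂ q) k rewrite +-◂ (pos (c ◂ mulSuc q k)) c q | mulSuc-+ q k = consOrd-pos c _

mulSuc<mulω : ∀ p k → pos (mulSuc p k) < pos (mulω p)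
mulSuc<mulω (top c) k = refl
mulSuc<mulω (c ◂ q) k rewrite mulSuc<mulω q k = refl

+-mulω : ∀ p → pos p + pos (mulω p) ≡ pos (mulω p)
+-mulω (top c) = refl
+-mulω (c ◂ q) rewrite +-◂ (pos (c ◂ q)) 0 (mulω q) | +-mulω q = refl

<ω⇒≡fromℕ : ∀ ξ → ξ < ω → ∃ λ j → ξ ≡ fromℕ j
<ω⇒≡fromℕ 𝟎                        _  = 0 , refl
<ω⇒≡fromℕ (pos (top c))            _  = suc c , refl
<ω⇒≡fromℕ (pos (zero  ◂ top zero))    ()
<ω⇒≡fromℕ (pos (suc _ ◂ top zero))    ()
<ω⇒≡fromℕ (pos (_     ◂ top (suc _))) ()
<ω⇒≡fromℕ (pos (_     ◂ (_ ◂ _)))     ()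

archimedean : Pos → Ord → ℕ
archimedean (top _) a = remω a
archimedean (_ ◂ q) a = archimedean q (quotω a)

<mulω⇒<mulSuc : ∀ p a → a < pos (mulω p) → a < pos (mulSuc p (archimedean p a))
<mulω⇒<mulSuc (top c) a a<ω with <ω⇒≡fromℕ a a<ω
... | zero  , refl = refl
... | suc d , refl = <⇒cmpℕ≡lt (ℕ.s≤s (ℕₚ.m≤m+n d _))
<mulω⇒<mulSuc (c ◂ q) 𝟎             _ = refl
<mulω⇒<mulSuc (c ◂ q) (pos (top _)) _ = refl
<mulω⇒<mulSuc (c ◂ q) (pos (d ◂ r)) a<ω with cmpPos r (mulω q) in r?q
... | lt rewrite <mulω⇒<mulSuc q (pos r) r?q = refl
... | eq = ⊥-elim (cmpℕ[n,0]≢lt d a<ω)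
... | gt = case a<ω of λ ()

infixl 7 _·_
_·_ : Pos → ℕ → Ord
p · j = pos p * fromℕ j

·-zero : ∀ p → p · 0 ≡ 𝟎
·-zero p = *-𝟎 (pos p)

·-sucˡ : ∀ p j → p · suc j ≡ pos p + p · j
·-sucˡ p zero    rewrite *-fromℕ-suc p 0 | mulSuc-zero p | ·-zero p = sym (+-identityʳ (pos p))
·-sucˡ p (suc j) rewrite *-fromℕ-suc p (suc j) | *-fromℕ-suc p j = sym (+-mulSuc p j)

·-sucʳ : ∀ p j → p · suc j ≡ p · j + pos p
·-sucʳ p zero    rewrite *-fromℕ-suc p 0 | mulSuc-zero p | ·-zero p = sym (+-identityˡ (pos p))
·-sucʳ p (suc j) rewrite *-fromℕ-suc p (suc j) | *-fromℕ-suc p j = sym (mulSuc-+ p j)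

·-one : ∀ p → p · 1 ≡ pos p
·-one p = trans (·-sucʳ p 0) (trans (cong (_+ pos p) (·-zero p)) (+-identityˡ (pos p)))

·<*ω : ∀ p j → p · j < pos p * ω
·<*ω p zero    rewrite ·-zero p | *-ω p = refl
·<*ω p (suc j) rewrite *-ω p | *-fromℕ-suc p j = mulSuc<mulω p j

σ<σ*ω : ∀ p → pos p < pos p * ω
σ<σ*ω p = subst (_< pos p * ω) (·-one p) (·<*ω p 1)

+-*ω : ∀ p → pos p + pos p * ω ≡ pos p * ω
+-*ω p rewrite *-ω p = +-mulω p

<*ω⇒<· : ∀ p a → a < pos p * ω → a < p · suc (archimedean p a)
<*ω⇒<· p a a<σω rewrite *-fromℕ-suc p (archimedean p a) =
  <mulω⇒<mulSuc p a (subst (a <_) (*-ω p) a<σω)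

·+<*ω : ∀ p j δ → δ ≤ pos p → p · j + δ < pos p * ω
·+<*ω p j δ δ≤σ = begin-strict
  p · j + δ       ≤⟨ +-monoʳ-≤ (p · j) δ (pos p) δ≤σ ⟩
  p · j + pos p   ≡⟨ ·-sucʳ p j ⟨
  p · suc j       <⟨ ·<*ω p (suc j) ⟩
  pos p * ω       ∎

·+σ≤· : ∀ p {j j′} → j ℕ.< j′ → p · j + pos p ≤ p · j′
·+σ≤· p {j} {suc j′} (ℕ.s≤s j≤j′) with ℕₚ.m≤n⇒m<n∨m≡n j≤j′
... | inj₂ refl = inj₂ (sym (·-sucʳ p j))
... | inj₁ j<j′ = begin
  p · j + pos p    ≤⟨ ·+σ≤· p j<j′ ⟩
  p · j′           ≤⟨ ≤-+ (p · j′) (pos p) ⟩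
  p · j′ + pos p   ≡⟨ ·-sucʳ p j′ ⟨
  p · suc j′       ∎

Remainder : Pos → Ord → Ord → Set
Remainder p z r = ∃ λ j → p · j + r ≡ z × 𝟎 < r × r ≤ pos p

residueWithin : Pos → ℕ → Ord → Ord
residueWithin p zero    z = z
residueWithin p (suc k) z with cmpOrd z (pos p)
... | gt = residueWithin p k (z ∸ pos p)
... | _  = z

residue : Pos → Ord → Ord
residue p z = residueWithin p (archimedean p z) z

remainder-≤σ : ∀ p z → 𝟎 < z → z ≤ pos p → Remainder p z z
remainder-≤σ p z 𝟎<z z≤σ =
  0 , trans (cong (_+ z) (·-zero p)) (+-identityˡ z) , 𝟎<z , z≤σ

residueWithin-remainder : ∀ p k z → 𝟎 < z → z ≤ p · suc k →
                          Remainder p z (residueWithin p k z)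
residueWithin-remainder p zero z 𝟎<z z≤σ =
  remainder-≤σ p z 𝟎<z (subst (z ≤_) (·-one p) z≤σ)
residueWithin-remainder p (suc k) z 𝟎<z z≤ with cmpOrd z (pos p) in z?σ
... | lt = remainder-≤σ p z 𝟎<z (inj₁ z?σ)
... | eq = remainder-≤σ p z 𝟎<z (inj₂ (cmp≡eq⇒≡ z (pos p) z?σ))
... | gt =
  let j , σj+r≡z′ , 𝟎<r , r≤σ = residueWithin-remainder p k z′ 𝟎<z′ z′≤
  in suc j , step j (residueWithin p k z′) σj+r≡z′ , 𝟎<r , r≤σ
  where
  σ<z : pos p < z
  σ<z = trans (cmp-flip z (pos p)) (cong flipCmp z?σ)
  z′ = z ∸ pos p
  σ+z′≡z : pos p + z′ ≡ z
  σ+z′≡z = a+[z∸a]≡z (pos p) z (inj₁ σ<z)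
  𝟎<z′ : 𝟎 < z′
  𝟎<z′ = a<a+w⇒𝟎<w (pos p) z′ (subst (pos p <_) (sym σ+z′≡z) σ<z)
  z′≤ : z′ ≤ p · suc k
  z′≤ = +-cancelˡ-≤ (pos p) z′ (p · suc k)
          (subst₂ _≤_ (sym σ+z′≡z) (·-sucˡ p (suc k)) z≤)
  step : ∀ j r → p · j + r ≡ z′ → p · suc j + r ≡ z
  step j r e = begin-equality
    p · suc j + r         ≡⟨ cong (_+ r) (·-sucˡ p j) ⟩
    pos p + p · j + r     ≡⟨ +-assoc (pos p) (p · j) r ⟩
    pos p + (p · j + r)   ≡⟨ cong (pos p +_) e ⟩
    pos p + z′            ≡⟨ σ+z′≡z ⟩
    z                     ∎

residue-remainder : ∀ p z → 𝟎 < z → z < pos p * ω → Remainder p z (residue p z)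
residue-remainder p z 𝟎<z z<σω =
  residueWithin-remainder p (archimedean p z) z 𝟎<z (inj₁ (<*ω⇒<· p z z<σω))

·+-<-·+ : ∀ p {j j′} r r′ → j ℕ.< j′ → r ≤ pos p → 𝟎 < r′ →
          p · j + r < p · j′ + r′
·+-<-·+ p {j} {j′} r r′ j<j′ r≤σ 𝟎<r′ = begin-strict
  p · j + r       ≤⟨ +-monoʳ-≤ (p · j) r (pos p) r≤σ ⟩
  p · j + pos p   ≤⟨ ·+σ≤· p j<j′ ⟩
  p · j′          <⟨ <-+ (p · j′) r′ 𝟎<r′ ⟩
  p · j′ + r′     ∎

remainder-unique : ∀ p z {r r′} → Remainder p z r → Remainder p z r′ → r ≡ r′
remainder-unique p z {r} {r′} (j , e , 𝟎<r , r≤σ) (j′ , e′ , 𝟎<r′ , r′≤σ)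
  with ℕₚ.<-cmp j j′
... | tri< j<j′ _ _ = ⊥-elim (<-irrefl (trans e (sym e′)) (·+-<-·+ p r r′ j<j′ r≤σ 𝟎<r′))
... | tri≈ _ refl _ = +-cancelˡ-≡ (p · j) (trans e (sym e′))
... | tri> _ _ j′<j = ⊥-elim (<-irrefl (trans e′ (sym e)) (·+-<-·+ p r′ r j′<j r′≤σ 𝟎<r))

residue-·+ : ∀ p j y → 𝟎 < y → y ≤ pos p → residue p (p · j + y) ≡ y
residue-·+ p j y 𝟎<y y≤σ = remainder-unique p z
  (residue-remainder p z (𝟎<+ (p · j) y 𝟎<y) (·+<*ω p j y y≤σ)) (j , refl , 𝟎<y , y≤σ)
  where z = p · j + y

PeriodicFrom : {A : Set} → (Ord → A) → Ord → Pos → Set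
PeriodicFrom h B p = ∀ j δ → δ < pos p → h (B + (p · j + δ)) ≡ h (B + δ)

glue : {A : Set} → Ord → (Ord → A) → (Ord → A) → Ord → A
glue L h₁ h₂ y with cmpOrd y L
... | gt = h₂ (y ∸ L)
... | _  = h₁ y

glue-≤ : ∀ {A : Set} L (h₁ h₂ : Ord → A) y → y ≤ L → glue L h₁ h₂ y ≡ h₁ y
glue-≤ L h₁ h₂ y (inj₁ y<L) rewrite y<L = refl
glue-≤ L h₁ h₂ y (inj₂ refl) rewrite cmp-refl y = refl

glue-+ : ∀ {A : Set} L (h₁ h₂ : Ord → A) w → 𝟎 < w → glue L h₁ h₂ (L + w) ≡ h₂ w
glue-+ L h₁ h₂ w 𝟎<w rewrite cmp-flip L (L + w) | <-+ L w 𝟎<w | a+w∸a≡w L w = refl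

repeatω : {A : Set} → Pos → (Ord → A) → A → Ord → A
repeatω p h t z with cmpOrd z (pos p * ω)
... | lt = h (residue p z)
... | _  = t

repeatω-< : ∀ {A : Set} p (h : Ord → A) t z → z < pos p * ω →
            repeatω p h t z ≡ h (residue p z)
repeatω-< p h t z z<σω rewrite z<σω = refl

repeatω-*ω : ∀ {A : Set} p (h : Ord → A) t → repeatω p h t (pos p * ω) ≡ t
repeatω-*ω p h t rewrite cmp-refl (pos p * ω) = refl

repeatω-·+ : ∀ {A : Set} p (h : Ord → A) t j y → 𝟎 < y → y ≤ pos p →
             repeatω p h t (p · j + y) ≡ h y
repeatω-·+ p h t j y 𝟎<y y≤σ =
  trans (repeatω-< p h t (p · j + y) (·+<*ω p j y y≤σ)) (cong h (residue-·+ p j y 𝟎<y y≤σ))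

-- The local invariant behind d-maps onto a finite frame

module Invariant {n : ℕ} (R : Fin n → Fin n → Bool) where

  R⁼ : Fin n → Fin n → Set
  R⁼ t u = u ≡ t ⊎ R t u ≡ true

  PeriodicBelow : (Ord → Fin n) → Ord → Ord → Set
  PeriodicBelow h o z = ∃₂ λ B p → o < B × B + pos p * ω ≡ z × PeriodicFrom h B p

  -- above and isolated give continuity and discrete fibres at z, successors-hit gives
  -- openness, periodic gives hereditary ultimate periodicity.  Every witness lies above
  -- the left barrier o, which is what lets the invariant survive translation.
  record GoodAt (h : Ord → Fin n) (o z : Ord) : Set where
    field
      lower          : Ord
      o≤lower        : o ≤ lower
      lower<z        : lower < z
      above          : ∀ y → lower < y → y ≤ z → R⁼ (h z) (h y)
      isolated       : ∀ y → lower < y → y ≤ z → h y ≡ h z → y ≡ z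
      successors-hit : ∀ s → R (h z) s ≡ true → ∀ a → o ≤ a → a < z →
                       ∃ λ y → a < y × y ≤ z × h y ≡ s
      periodic       : Limit z → PeriodicBelow h o z

  GoodOn : (Ord → Fin n) → Ord → Ord → Set
  GoodOn h o U = ∀ z → o < z → z ≤ U → GoodAt h o z

  GoodAt-weaken : ∀ {h o o′ z} → o ≤ o′ → o′ < z → GoodAt h o′ z → GoodAt h o z
  GoodAt-weaken {h} {o} {o′} {z} o≤o′ o′<z G = record
    { lower          = lower
    ; o≤lower        = ≤-trans {o} {o′} {lower} o≤o′ o≤lower
    ; lower<z        = lower<z
    ; above          = above
    ; isolated       = isolated
    ; successors-hit = hit
    ; periodic       = λ lim → let B , p , o′<B , rest = periodic lim in
                         B , p , ≤-<-trans {o} {o′} {B} o≤o′ o′<B , rest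
    }
    where
    open GoodAt G
    hit : ∀ s → R (h z) s ≡ true → ∀ a → o ≤ a → a < z →
          ∃ λ y → a < y × y ≤ z × h y ≡ s
    hit s zRs a _ a<z with <-cmp a o′
    ... | tri< a<o′ _ _ = let y , o′<y , rest = successors-hit s zRs o′ ≤-refl o′<z in
                          y , <-trans {a} {o′} {y} a<o′ o′<y , rest
    ... | tri≈ _ a≡o′ _ = successors-hit s zRs a (inj₂ (sym a≡o′)) a<z
    ... | tri> _ _ o′<a = successors-hit s zRs a (inj₁ o′<a) a<z

  GoodOn-trans : ∀ {h o U₁ U₂} → o ≤ U₁ →
                 GoodOn h o U₁ → GoodOn h U₁ U₂ → GoodOn h o U₂
  GoodOn-trans {U₁ = U₁} o≤U₁ G₁ G₂ z o<z z≤U₂ with <-cmp z U₁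
  ... | tri< z<U₁ _ _ = G₁ z o<z (inj₁ z<U₁)
  ... | tri≈ _ z≡U₁ _ = G₁ z o<z (inj₂ z≡U₁)
  ... | tri> _ _ U₁<z = GoodAt-weaken o≤U₁ U₁<z (G₂ z U₁<z z≤U₂)

  PeriodicBelow-translate : ∀ {h h′ o w} → (∀ y → 𝟎 < y → y ≤ w → h′ (o + y) ≡ h y) →
                            PeriodicBelow h 𝟎 w → PeriodicBelow h′ o (o + w)
  PeriodicBelow-translate {h} {h′} {o} {w} agree (B , p , 𝟎<B , B+σω≡w , periodic) =
    o + B , p , <-+ o B 𝟎<B , trans (+-assoc o B (pos p * ω)) (cong (o +_) B+σω≡w) , periodic′
    where
    agree′ : ∀ x → x < pos p * ω → h′ (o + B + x) ≡ h (B + x)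
    agree′ x x<σω = trans (cong h′ (+-assoc o B x)) (agree (B + x) 𝟎<B+x B+x≤w)
      where
      𝟎<B+x : 𝟎 < B + x
      𝟎<B+x = <-≤-trans {𝟎} {B} {B + x} 𝟎<B (≤-+ B x)
      B+x≤w : B + x ≤ w
      B+x≤w = inj₁ (subst (B + x <_) B+σω≡w (+-monoʳ-< B x (pos p * ω) x<σω))
    periodic′ : PeriodicFrom h′ (o + B) p
    periodic′ j δ δ<σ =
      trans (agree′ (p · j + δ) (·+<*ω p j δ (inj₁ δ<σ)))
            (trans (periodic j δ δ<σ) (sym (agree′ δ δ<σω)))
      where
      δ<σω : δ < pos p * ω
      δ<σω = <-trans {δ} {pos p} {pos p * ω} δ<σ (σ<σ*ω p)

  GoodAt-translate : ∀ {h h′ o w} → GoodAt h 𝟎 w →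
                     (∀ y → 𝟎 < y → y ≤ w → h′ (o + y) ≡ h y) → GoodAt h′ o (o + w)
  GoodAt-translate {h} {h′} {o} {w} G agree = record
    { lower          = o + lower
    ; o≤lower        = ≤-+ o lower
    ; lower<z        = +-monoʳ-< o lower w lower<z
    ; above          = above′
    ; isolated       = isolated′
    ; successors-hit = hit
    ; periodic       = λ lim →
        PeriodicBelow-translate {h} {h′} {o} {w} agree (periodic (Limit-+ o w 𝟎<w lim))
    }
    where
    open GoodAt G
    𝟎<w : 𝟎 < w
    𝟎<w = ≤-<-trans {𝟎} {lower} {w} o≤lower lower<z
    agree-above : ∀ y → lower < y → y ≤ w → h′ (o + y) ≡ h y
    agree-above y l<y = agree y (≤-<-trans {𝟎} {lower} {y} o≤lower l<y)
    o≤ : ∀ y → o + lower < y → o ≤ y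
    o≤ y l<y = inj₁ (≤-<-trans {o} {o + lower} {y} (≤-+ o lower) l<y)
    above′ : ∀ y → o + lower < y → y ≤ o + w → R⁼ (h′ (o + w)) (h′ y)
    above′ y l<y y≤z with a≤z⇒∃[w]a+w≡z o y (o≤ y l<y)
    ... | y′ , refl with +-cancelˡ-< o lower y′ l<y | +-cancelˡ-≤ o y′ w y≤z
    ... | l<y′ | y′≤w rewrite agree-above w lower<z ≤-refl | agree-above y′ l<y′ y′≤w =
      above y′ l<y′ y′≤w
    isolated′ : ∀ y → o + lower < y → y ≤ o + w → h′ y ≡ h′ (o + w) → y ≡ o + w
    isolated′ y l<y y≤z with a≤z⇒∃[w]a+w≡z o y (o≤ y l<y)
    ... | y′ , refl with +-cancelˡ-< o lower y′ l<y | +-cancelˡ-≤ o y′ w y≤z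
    ... | l<y′ | y′≤w rewrite agree-above w lower<z ≤-refl | agree-above y′ l<y′ y′≤w =
      cong (o +_) ∘ isolated y′ l<y′ y′≤w
    hit : ∀ s → R (h′ (o + w)) s ≡ true → ∀ a → o ≤ a → a < o + w →
          ∃ λ y → a < y × y ≤ o + w × h′ y ≡ s
    hit s zRs a o≤a a<z with a≤z⇒∃[w]a+w≡z o a o≤a
    ... | a′ , refl rewrite agree-above w lower<z ≤-refl
      with successors-hit s zRs a′ (𝟎≤ a′) (+-cancelˡ-< o a′ w a<z)
    ... | y , a′<y , y≤w , hy≡s =
      o + y , +-monoʳ-< o a′ y a′<y , +-monoʳ-≤ o y w y≤w ,
      trans (agree y (≤-<-trans {𝟎} {a′} {y} (𝟎≤ a′) a′<y) y≤w) hy≡s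

  GoodOn-translate : ∀ {h h′ o L} → (∀ y → 𝟎 < y → y ≤ L → h′ (o + y) ≡ h y) →
                     GoodOn h 𝟎 L → GoodOn h′ o (o + L)
  GoodOn-translate {h} {h′} {o} {L} agree G z o<z z≤o+L with a≤z⇒∃[w]a+w≡z o z (inj₁ o<z)
  ... | w , refl = GoodAt-translate (G w (a<a+w⇒𝟎<w o w o<z) w≤L)
                     (λ y 𝟎<y y≤w → agree y 𝟎<y (≤-trans {y} {w} {L} y≤w w≤L))
    where
    w≤L : w ≤ L
    w≤L = +-cancelˡ-≤ o w L z≤o+L

  GoodOn-cong : ∀ {h h′ L} → (∀ y → 𝟎 < y → y ≤ L → h′ y ≡ h y) →
                GoodOn h 𝟎 L → GoodOn h′ 𝟎 L
  GoodOn-cong {h} {h′} {L} agree G = subst (GoodOn h′ 𝟎) (+-identityˡ L)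
    (GoodOn-translate (λ y 𝟎<y y≤L → trans (cong h′ (+-identityˡ y)) (agree y 𝟎<y y≤L)) G)

  glue-GoodOn : ∀ {h₁ h₂ L₁ L₂} → GoodOn h₁ 𝟎 L₁ → GoodOn h₂ 𝟎 L₂ →
                GoodOn (glue L₁ h₁ h₂) 𝟎 (L₁ + L₂)
  glue-GoodOn {h₁} {h₂} {L₁} {L₂} G₁ G₂ = GoodOn-trans (𝟎≤ L₁)
    (GoodOn-cong (λ y _ y≤L₁ → glue-≤ L₁ h₁ h₂ y y≤L₁) G₁)
    (GoodOn-translate (λ w 𝟎<w _ → glue-+ L₁ h₁ h₂ w 𝟎<w) G₂)

  record RootedAt (t : Fin n) (L : Ord) (f : Ord → Fin n) : Set where
    field
      𝟎<L   : 𝟎 < L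
      f-L   : f L ≡ t
      below : ∀ z → 𝟎 < z → z < L → R t (f z) ≡ true
      good  : GoodOn f 𝟎 L

  const-RootedAt : ∀ t → (∀ s → R t s ≡ false) → RootedAt t 𝟏 (λ _ → t)
  const-RootedAt t no-successor = record
    { 𝟎<L   = refl
    ; f-L   = refl
    ; below = λ z 𝟎<z z<𝟏 → ⊥-elim (≤⇒≯ {𝟏} {z} (𝟎<⇒𝟏≤ z 𝟎<z) z<𝟏)
    ; good  = λ z 𝟎<z z≤𝟏 → record
      { lower          = 𝟎
      ; o≤lower        = ≤-refl
      ; lower<z        = 𝟎<z
      ; above          = λ _ _ _ → inj₁ refl
      ; isolated       = λ y 𝟎<y y≤z _ →
          trans (≡𝟏 y 𝟎<y (≤-trans {y} {z} {𝟏} y≤z z≤𝟏)) (sym (≡𝟏 z 𝟎<z z≤𝟏))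
      ; successors-hit = λ s tRs → case trans (sym tRs) (no-successor s) of λ ()
      ; periodic       = λ lim → ⊥-elim (𝟏-not-limit (subst Limit (≡𝟏 z 𝟎<z z≤𝟏) lim))
      }
    }
    where
    ≡𝟏 : ∀ z → 𝟎 < z → z ≤ 𝟏 → z ≡ 𝟏
    ≡𝟏 z 𝟎<z z≤𝟏 = ≤-antisym z≤𝟏 (𝟎<⇒𝟏≤ z 𝟎<z)

  module _ {t : Fin n} {p : Pos} {h : Ord → Fin n}
           (G      : GoodOn h 𝟎 (pos p))
           (inside : ∀ y → 𝟎 < y → y ≤ pos p → R t (h y) ≡ true)
           (onto   : ∀ s → R t s ≡ true → ∃ λ y → 𝟎 < y × y ≤ pos p × h y ≡ s)
           (t-irrefl : R t t ≡ false)
           where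

    private
      f : Ord → Fin n
      f = repeatω p h t

      σω = pos p * ω

      𝟎<σω : 𝟎 < σω
      𝟎<σω = <-trans {𝟎} {pos p} {σω} refl (σ<σ*ω p)

    repeatω-below : ∀ z → 𝟎 < z → z < σω → R t (f z) ≡ true
    repeatω-below z 𝟎<z z<σω =
      let _ , _ , 𝟎<r , r≤σ = residue-remainder p z 𝟎<z z<σω in
      subst (λ u → R t u ≡ true) (sym (repeatω-< p h t z z<σω)) (inside (residue p z) 𝟎<r r≤σ)

    repeatω-GoodAt-·+ : ∀ j r → 𝟎 < r → r ≤ pos p → GoodAt f 𝟎 (p · j + r)
    repeatω-GoodAt-·+ j r 𝟎<r r≤σ =
      GoodAt-weaken (𝟎≤ (p · j)) σj<z
        (block (p · j + r) σj<z (+-monoʳ-≤ (p · j) r (pos p) r≤σ))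
      where
      block : GoodOn f (p · j) (p · j + pos p)
      block = GoodOn-translate (λ y 𝟎<y y≤σ → repeatω-·+ p h t j y 𝟎<y y≤σ) G
      σj<z : p · j < p · j + r
      σj<z = <-+ (p · j) r 𝟎<r

    repeatω-period : ∀ j δ → δ < pos p → f (p · suc j + δ) ≡ f (p · 1 + δ)
    repeatω-period j 𝟎 _
      rewrite +-identityʳ (p · suc j) | +-identityʳ (p · 1) | ·-sucʳ p j | ·-sucʳ p 0 =
      trans (repeatω-·+ p h t j (pos p) refl ≤-refl) (sym (repeatω-·+ p h t 0 (pos p) refl ≤-refl))
    repeatω-period j (pos q) q<σ =
      trans (repeatω-·+ p h t (suc j) (pos q) refl (inj₁ q<σ))
            (sym (repeatω-·+ p h t 1 (pos q) refl (inj₁ q<σ)))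

    repeatω-GoodAt-*ω : GoodAt f 𝟎 σω
    repeatω-GoodAt-*ω = record
      { lower          = 𝟎
      ; o≤lower        = ≤-refl
      ; lower<z        = 𝟎<σω
      ; above          = above
      ; isolated       = isolated
      ; successors-hit = hit
      ; periodic       = λ _ → pos p , p , refl , +-*ω p , periodic
      }
      where
      f-σω : f σω ≡ t
      f-σω = repeatω-*ω p h t
      above : ∀ y → 𝟎 < y → y ≤ σω → R⁼ (f σω) (f y)
      above y _   (inj₂ refl) = inj₁ refl
      above y 𝟎<y (inj₁ y<σω) rewrite f-σω = inj₂ (repeatω-below y 𝟎<y y<σω)
      isolated : ∀ y → 𝟎 < y → y ≤ σω → f y ≡ f σω → y ≡ σω
      isolated y _   (inj₂ refl) _ = refl
      isolated y 𝟎<y (inj₁ y<σω) fy≡t rewrite f-σω =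
        case trans (sym (subst (λ u → R t u ≡ true) fy≡t (repeatω-below y 𝟎<y y<σω))) t-irrefl
        of λ ()
      hit : ∀ s → R (f σω) s ≡ true → ∀ a → 𝟎 ≤ a → a < σω →
            ∃ λ y → a < y × y ≤ σω × f y ≡ s
      hit s tRs a _ a<σω rewrite f-σω =
        let y , 𝟎<y , y≤σ , hy≡s = onto s tRs
            j = suc (archimedean p a)
        in p · j + y
         , <-≤-trans {a} {p · j} {p · j + y} (<*ω⇒<· p a a<σω) (≤-+ (p · j) y)
         , inj₁ (·+<*ω p j y y≤σ)
         , trans (repeatω-·+ p h t j y 𝟎<y y≤σ) hy≡s
      periodic : PeriodicFrom f (pos p) p
      periodic j δ δ<σ =
        trans (cong f σ+[σj+δ]≡σ[j+1]+δ)
              (trans (repeatω-period j δ δ<σ) (cong (f ∘ (_+ δ)) (·-one p)))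
        where
        σ+[σj+δ]≡σ[j+1]+δ : pos p + (p · j + δ) ≡ p · suc j + δ
        σ+[σj+δ]≡σ[j+1]+δ =
          trans (sym (+-assoc (pos p) (p · j) δ)) (cong (_+ δ) (sym (·-sucˡ p j)))

    repeatω-RootedAt : RootedAt t σω f
    repeatω-RootedAt = record
      { 𝟎<L   = 𝟎<σω
      ; f-L   = repeatω-*ω p h t
      ; below = repeatω-below
      ; good  = good
      }
      where
      good : GoodOn f 𝟎 σω
      good z _   (inj₂ refl)  = repeatω-GoodAt-*ω
      good z 𝟎<z (inj₁ z<σω) =
        let j , e , 𝟎<r , r≤σ = residue-remainder p z 𝟎<z z<σω in
        subst (GoodAt f 𝟎) e (repeatω-GoodAt-·+ j (residue p z) 𝟎<r r≤σ)

InI? : ∀ Λ x → Dec (InI Λ x)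
InI? Λ x = NonStrict.decidable′ <-cmp 𝟏 x ×-dec NonStrict.decidable′ <-cmp x Λ

InI-intro : ∀ {Λ} x → 𝟎 < x → x ≤ Λ → InI Λ x
InI-intro x 𝟎<x x≤Λ = 𝟎<⇒𝟏≤ x 𝟎<x , x≤Λ

InI⇒𝟎< : ∀ {Λ x} → InI Λ x → 𝟎 < x
InI⇒𝟎< {x = x} (𝟏≤x , _) = 𝟏≤⇒𝟎< x 𝟏≤x

in-left-nbhd : ∀ {Λ a x y} → 𝟎 ≤ a → InI Λ x → Interval a (x + 𝟏) y →
               InI Λ y × a < y × y ≤ x
in-left-nbhd {Λ} {a} {x} {y} 𝟎≤a (_ , x≤Λ) (a<y , y<x+𝟏) =
  InI-intro y (≤-<-trans {𝟎} {a} {y} 𝟎≤a a<y) (≤-trans {y} {x} {Λ} y≤x x≤Λ) , a<y , y≤x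
  where
  y≤x = <+𝟏⇒≤ y x y<x+𝟏

periodic⇒UPin : ∀ (P : Ord → Bool) B p → PeriodicFrom P B p → UPin P (B + pos p * ω)
periodic⇒UPin P B p periodic =
  ⟨ B , P ⟩ , ⟨ pos p * ω , (λ u → P (B + u)) ⟩ ,
  (⟨ pos p , (λ δ → P (B + δ)) ⟩ , ω , ω-limit , (λ ()) , refl , power) ,
  refl , (λ _ _ → refl) , (λ _ _ → refl)
  where
  power : ∀ ξ δ → ξ < ω → δ < pos p → P (B + (pos p * ξ + δ)) ≡ P (B + δ)
  power ξ δ ξ<ω δ<σ with <ω⇒≡fromℕ ξ ξ<ω
  ... | j , refl = periodic j δ δ<σ

module FromInvariant {n : ℕ} (R : Fin n → Fin n → Bool) {Λ : Ord} {f : Ord → Fin n} where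

  open Invariant R

  module _ (G : GoodOn f 𝟎 Λ) where

    private
      good-at : ∀ x → InI Λ x → GoodAt f 𝟎 x
      good-at x Ix@(_ , x≤Λ) = G x (InI⇒𝟎< Ix) x≤Λ

    GoodOn⇒Continuous : Continuous R Λ f
    GoodOn⇒Continuous U upset = V , V-open , λ x → (λ Vx → Vx , proj₁ Vx) , proj₁
      where
      V : Ord → Set
      V x = InI Λ x × U (f x)
      V-open : OpenOrd V
      V-open x (Ix , Ufx) = inj₂ (lower , x + 𝟏 , (lower<z , x<x+𝟏 x) , nbhd⊆V)
        where
        open GoodAt (good-at x Ix)
        nbhd⊆V : ∀ y → Interval lower (x + 𝟏) y → V y
        nbhd⊆V y l<y<x+𝟏 with in-left-nbhd o≤lower Ix l<y<x+𝟏
        ... | Iy , l<y , y≤x with above y l<y y≤x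
        ...   | inj₁ fy≡fx = Iy , subst U (sym fy≡fx) Ufx
        ...   | inj₂ fxRfy = Iy , upset (f x) (f y) Ufx fxRfy

    GoodOn⇒OpenMap : OpenMap R Λ f
    GoodOn⇒OpenMap U (V , V-open , U⇔V) s t (x , Ux , fx≡s) sRt
      with proj₁ (U⇔V x) Ux
    ... | Vx , Ix with V-open x Vx
    ...   | inj₁ x≡𝟎 = ⊥-elim (<-irrefl (sym x≡𝟎) (InI⇒𝟎< Ix))
    ...   | inj₂ (a , b , (a<x , x<b) , ab⊆V)
      with GoodAt.successors-hit (good-at x Ix) t (subst (λ u → R u t ≡ true) (sym fx≡s) sRt)
             a (𝟎≤ a) a<x
    ...     | y , a<y , y≤x , fy≡t =
      y , proj₂ (U⇔V y) (ab⊆V y (a<y , ≤-<-trans {y} {x} {b} y≤x x<b) , Iy) , fy≡t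
      where
      Iy : InI Λ y
      Iy = InI-intro y (≤-<-trans {𝟎} {a} {y} (𝟎≤ a) a<y)
                       (≤-trans {y} {x} {Λ} y≤x (proj₂ Ix))

    GoodOn⇒DiscreteFibers : DiscreteFibers R Λ f
    GoodOn⇒DiscreteFibers x Ix =
      W , (Interval lower (x + 𝟏) , nbhd-open , λ _ → (λ Wy → Wy) , (λ Wy → Wy)) ,
      ((lower<z , x<x+𝟏 x) , Ix) , only-x
      where
      open GoodAt (good-at x Ix)
      W : Ord → Set
      W y = Interval lower (x + 𝟏) y × InI Λ y
      nbhd-open : OpenOrd (Interval lower (x + 𝟏))
      nbhd-open y y∈ = inj₂ (lower , x + 𝟏 , y∈ , λ _ y′∈ → y′∈)
      only-x : ∀ y → W y → f y ≡ f x → y ≡ x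
      only-x y (y∈ , _) with in-left-nbhd o≤lower Ix y∈
      ... | _ , l<y , y≤x = isolated y l<y y≤x

    GoodOn⇒InH0 : ∀ (A : Fin n → Bool) → InH0 Λ (λ x → A (f x))
    GoodOn⇒InH0 A = P , (P⇒<Λ+𝟏 , up) , P-agrees
      where
      P : Ord → Bool
      P γ with InI? Λ γ
      ... | yes _ = A (f γ)
      ... | no  _ = false
      P-agrees : ∀ γ → InI Λ γ → P γ ≡ A (f γ)
      P-agrees γ Iγ with InI? Λ γ
      ... | yes _  = refl
      ... | no ¬Iγ = ⊥-elim (¬Iγ Iγ)
      P⇒<Λ+𝟏 : ∀ γ → P γ ≡ true → γ < Λ + 𝟏
      P⇒<Λ+𝟏 γ Pγ with InI? Λ γ
      ... | yes (_ , γ≤Λ) = ≤-<-trans {γ} {Λ} {Λ + 𝟏} γ≤Λ (x<x+𝟏 Λ)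
      ... | no  _         = case Pγ of λ ()
      periodic-up : ∀ {β} → β ≤ Λ → PeriodicBelow f 𝟎 β → UPin P β
      periodic-up β≤Λ (B , p , 𝟎<B , refl , f-periodic) = periodic⇒UPin P B p P-periodic
        where
        I-B+ : ∀ x → x < pos p * ω → InI Λ (B + x)
        I-B+ x x<σω = InI-intro (B + x) (<-≤-trans {𝟎} {B} {B + x} 𝟎<B (≤-+ B x))
                        (≤-trans {B + x} {B + pos p * ω} {Λ}
                          (inj₁ (+-monoʳ-< B x (pos p * ω) x<σω)) β≤Λ)
        P-periodic : PeriodicFrom P B p
        P-periodic j δ δ<σ
          rewrite P-agrees (B + (p · j + δ)) (I-B+ (p · j + δ) (·+<*ω p j δ (inj₁ δ<σ)))
                | P-agrees (B + δ) (I-B+ δ (<-trans {δ} {pos p} {pos p * ω} δ<σ (σ<σ*ω p)))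
                | f-periodic j δ δ<σ = refl
      up : ∀ β → Limit β → β ≤ Λ + 𝟏 → UPin P β
      up β lim β≤Λ+𝟏 =
        periodic-up β≤Λ (GoodAt.periodic (G β (≢𝟎⇒𝟎< (proj₁ lim)) β≤Λ) lim)
        where
        β≤Λ = Limit-≤+𝟏 β Λ lim β≤Λ+𝟏

  module _ {r : Fin n} (F : RootedAt r Λ f) where

    open RootedAt F

    Λ∈I : InI Λ Λ
    Λ∈I = InI-intro Λ 𝟎<L ≤-refl

    RootedAt-onto : (∀ t → t ≢ r → R r t ≡ true) → ∀ t → ∃ λ x → InI Λ x × f x ≡ t
    RootedAt-onto r-sees t with t ≟ᶠ r
    ... | yes refl = Λ , Λ∈I , f-L
    ... | no  t≢r
      with GoodAt.successors-hit (good Λ 𝟎<L ≤-refl) t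
             (subst (λ u → R u t ≡ true) (sym f-L) (r-sees t t≢r)) 𝟎 ≤-refl 𝟎<L
    ...   | y , 𝟎<y , y≤Λ , fy≡t = y , InI-intro y 𝟎<y y≤Λ , fy≡t

    RootedAt-fibre : R r r ≡ false → ∀ x → InI Λ x → f x ≡ r → x ≡ Λ
    RootedAt-fibre r-irrefl x (_ , inj₂ x≡Λ) _ = x≡Λ
    RootedAt-fibre r-irrefl x Ix@(_ , inj₁ x<Λ) fx≡r =
      case trans (sym (subst (λ u → R r u ≡ true) fx≡r (below x (InI⇒𝟎< Ix) x<Λ))) r-irrefl
      of λ ()

filter-absorbs : ∀ {A : Set} {P Q : A → Set} (P? : Decidable P) (Q? : Decidable Q) →
                 (∀ {x} → P x → Q x) → ∀ xs → filter P? (filter Q? xs) ≡ filter P? xs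
filter-absorbs P? Q? P⇒Q [] = refl
filter-absorbs P? Q? P⇒Q (x ∷ xs) with Q? x | P? x
... | yes _  | yes px = trans (filter-accept P? px) (cong (x ∷_) (filter-absorbs P? Q? P⇒Q xs))
... | yes _  | no ¬px = trans (filter-reject P? ¬px) (filter-absorbs P? Q? P⇒Q xs)
... | no ¬qx | yes px = ⊥-elim (¬qx (P⇒Q px))
... | no _   | no _   = filter-absorbs P? Q? P⇒Q xs

module Construction {n : ℕ} (R : Fin n → Fin n → Bool)
                    (R-irrefl : Irreflexive R) (R-trans : Transitive R) where

  open Invariant R

  successors : Fin n → List (Fin n)
  successors t = filter (λ s → R t s ≟ true) (allFin n)

  ∈-successors⁺ : ∀ {t s} → R t s ≡ true → s ∈ successors t
  ∈-successors⁺ {t} {s} tRs = ∈-filter⁺ (λ u → R t u ≟ true) (∈-allFin s) tRs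

  ∈-successors⁻ : ∀ {t s} → s ∈ successors t → R t s ≡ true
  ∈-successors⁻ {t} m = proj₂ (∈-filter⁻ (λ u → R t u ≟ true) {xs = allFin n} m)

  successors-shrink : ∀ {t s} → R t s ≡ true → length (successors s) ℕ.< length (successors t)
  successors-shrink {t} {s} tRs =
    subst (ℕ._< length (successors t))
      (cong length (filter-absorbs P? Q? (R-trans t s _ tRs) (allFin n)))
      (filter-notAll P? (successors t) (Any.map (λ { refl → ¬sRs }) (∈-successors⁺ tRs)))
    where
    P? = λ x → R s x ≟ true
    Q? = λ x → R t x ≟ true
    ¬sRs : R s s ≢ true
    ¬sRs sRs = case trans (sym sRs) (R-irrefl s) of λ ()

  Height≤ : ℕ → Fin n → Set
  Height≤ zero    t = ∀ s → R t s ≡ false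
  Height≤ (suc k) t = ∀ s → R t s ≡ true → Height≤ k s

  Height≤-successors : ∀ m t → length (successors t) ℕ.≤ m → Height≤ m t
  Height≤-successors zero t len≤0 s =
    ¬-not λ tRs → ℕₚ.<⇒≱ (∈-length (∈-successors⁺ {t} tRs)) len≤0
  Height≤-successors (suc m) t len≤ s tRs =
    Height≤-successors m s (ℕₚ.≤-pred (ℕₚ.<-≤-trans (successors-shrink tRs) len≤))

  nodeSpan : Ord → Ord
  nodeSpan 𝟎       = 𝟏
  nodeSpan (pos p) = pos p * ω

  node : Fin n → Ord → (Ord → Fin n) → Ord → Fin n
  node t 𝟎       h = λ _ → t
  node t (pos p) h = repeatω p h t

  mutual
    span : ℕ → Fin n → Ord
    span zero    t = 𝟏
    span (suc k) t = nodeSpan (spans k (successors t))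

    spans : ℕ → List (Fin n) → Ord
    spans k []       = 𝟎
    spans k (s ∷ ss) = span k s + spans k ss

  mutual
    label : ℕ → Fin n → Ord → Fin n
    label zero    t = λ _ → t
    label (suc k) t = node t (spans k (successors t)) (labels k t (successors t))

    labels : ℕ → Fin n → List (Fin n) → Ord → Fin n
    labels k t []       = λ _ → t
    labels k t (s ∷ ss) = glue (span k s) (label k s) (labels k t ss)

  record Blocks (t : Fin n) (ss : List (Fin n)) (L : Ord) (h : Ord → Fin n) : Set where
    field
      good   : GoodOn h 𝟎 L
      inside : ∀ y → 𝟎 < y → y ≤ L → R t (h y) ≡ true
      onto   : ∀ s → s ∈ ss → ∃ λ y → 𝟎 < y × y ≤ L × h y ≡ s

  labels-Blocks : ∀ k t ss → (∀ s → s ∈ ss → R t s ≡ true) →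
                  (∀ s → s ∈ ss → RootedAt s (span k s) (label k s)) →
                  Blocks t ss (spans k ss) (labels k t ss)
  labels-Blocks k t [] _ _ = record
    { good   = λ z 𝟎<z z≤𝟎 → ⊥-elim (≤⇒≯ {z} {𝟎} z≤𝟎 𝟎<z)
    ; inside = λ y 𝟎<y y≤𝟎 → ⊥-elim (≤⇒≯ {y} {𝟎} y≤𝟎 𝟎<y)
    ; onto   = λ s ()
    }
  labels-Blocks k t (s ∷ ss) tR rooted = record
    { good   = glue-GoodOn good (Blocks.good rest)
    ; inside = inside′
    ; onto   = onto′
    }
    where
    open RootedAt (rooted s (here refl))
    rest = labels-Blocks k t ss (λ s′ → tR s′ ∘ there) (λ s′ → rooted s′ ∘ there)
    L₁ = span k s
    h = labels k t (s ∷ ss)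
    h-left : ∀ y → y ≤ L₁ → h y ≡ label k s y
    h-left = glue-≤ L₁ (label k s) (labels k t ss)
    h-right : ∀ w → 𝟎 < w → h (L₁ + w) ≡ labels k t ss w
    h-right = glue-+ L₁ (label k s) (labels k t ss)
    tRs : R t s ≡ true
    tRs = tR s (here refl)
    inside′ : ∀ y → 𝟎 < y → y ≤ L₁ + spans k ss → R t (h y) ≡ true
    inside′ y 𝟎<y y≤ with <-cmp y L₁
    ... | tri< y<L₁ _ _ rewrite h-left y (inj₁ y<L₁) = R-trans t s _ tRs (below y 𝟎<y y<L₁)
    ... | tri≈ _ refl _ rewrite h-left y ≤-refl | f-L = tRs
    ... | tri> _ _ L₁<y with a≤z⇒∃[w]a+w≡z L₁ y (inj₁ L₁<y)
    ...   | w , refl rewrite h-right w (a<a+w⇒𝟎<w L₁ w L₁<y) =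
      Blocks.inside rest w (a<a+w⇒𝟎<w L₁ w L₁<y) (+-cancelˡ-≤ L₁ w (spans k ss) y≤)
    onto′ : ∀ s′ → s′ ∈ s ∷ ss →
            ∃ λ y → 𝟎 < y × y ≤ L₁ + spans k ss × h y ≡ s′
    onto′ s′ (here refl) = L₁ , 𝟎<L , ≤-+ L₁ (spans k ss) , trans (h-left L₁ ≤-refl) f-L
    onto′ s′ (there m) =
      let w , 𝟎<w , w≤ , hw≡s′ = Blocks.onto rest s′ m in
      L₁ + w , 𝟎<+ L₁ w 𝟎<w , +-monoʳ-≤ L₁ w (spans k ss) w≤ ,
      trans (h-right w 𝟎<w) hw≡s′

  node-RootedAt : ∀ {t σ h} → Blocks t (successors t) σ h →
                  RootedAt t (nodeSpan σ) (node t σ h)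
  node-RootedAt {t} {𝟎} B = const-RootedAt t λ s → ¬-not λ tRs →
    let y , 𝟎<y , y≤𝟎 , _ = Blocks.onto B s (∈-successors⁺ tRs)
    in ≤⇒≯ {y} {𝟎} y≤𝟎 𝟎<y
  node-RootedAt {t} {pos p} B =
    repeatω-RootedAt good inside (λ s tRs → onto s (∈-successors⁺ tRs)) (R-irrefl t)
    where open Blocks B

  label-RootedAt : ∀ k t → Height≤ k t → RootedAt t (span k t) (label k t)
  label-RootedAt zero    t leaf   = const-RootedAt t leaf
  label-RootedAt (suc k) t height = node-RootedAt (labels-Blocks k t (successors t)
    (λ s → ∈-successors⁻)
    (λ s s∈ → label-RootedAt k s (height s (∈-successors⁻ s∈))))

lemma6p2 : (n : ℕ) (R : Fin n → Fin n → Bool) (r : Fin n) →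
    Irreflexive R → Transitive R → TreeLike R r →
    Σ Ord λ lam → Σ (Ord → Fin n) λ f →
      (∀ t → ∃ λ x → InI lam x × f x ≡ t)
      × DMap R lam f
      × (∀ (A : Fin n → Bool) → InH0 lam (λ x → A (f x)))
      × InI lam lam
      × f lam ≡ r
      × (∀ x → InI lam x → f x ≡ r → x ≡ lam)
lemma6p2 n R r R-irrefl R-trans (r-sees , _) =
  Λ , f , RootedAt-onto F r-sees ,
  (GoodOn⇒Continuous good , GoodOn⇒OpenMap good , GoodOn⇒DiscreteFibers good) ,
  GoodOn⇒InH0 good , Λ∈I F , f-L , RootedAt-fibre F (R-irrefl r)
  where
  open Construction R R-irrefl R-trans
  open FromInvariant R
  k = length (successors r)
  Λ = span k r
  f = label k r
  F = label-RootedAt k r (Height≤-successors k r ℕₚ.≤-refl)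
  open Invariant.RootedAt F
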